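{- For all integers $0\le m\le n$, \[\sum_{i=m}^n(-1)^{n-i}\binom{n+i}{2i}\binom{i+1}{m+1}C_i=\binom{m+n}{2m}C_m,\] where $C_i=\frac{1}{i+1}\binom{2i}{i}$ is the $i$-th Catalan number. -}

module Defs where

open import Data.Nat using (ℕ; zero; suc; _+_; _*_; _∸_; _/_)
open import Data.Nat.Combinatorics using (_C_)
open import Data.Integer as ℤ using (ℤ; +_)

-- i-th Catalan number C_i = (1/(i+1)) * binom(2i, i)  (exact division in ℕ)
catalan : ℕ → ℕ
catalan i = ((2 * i) C i) / suc i

sign : ℕ → ℤ
sign zero = ℤ.+ 1
sign (suc k) = ℤ.- sign k

-- Σ_{i=m}^{m+k} f i   (k+1 terms)
sumFrom : ℕ → ℕ → (ℕ → ℤ) → ℤ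
sumFrom m zero f = f m
sumFrom m (suc k) f = sumFrom m k f ℤ.+ f (m + suc k)

-- Σ_{i=m}^{n} f i for m ≤ n (empty sum not needed under the hypothesis m ≤ n)
sumRange : ℕ → ℕ → (ℕ → ℤ) → ℤ
sumRange m n f = sumFrom m (n ∸ m) f

module Submission where

-- Write n = m + k and i = m + j with 0 ≤ j ≤ k.  Multiplied by
-- (m+1), each summand factors through binomial identities (absorption, the
-- Catalan formula (i+1)·C_i = (2i choose i) and trinomial revision) as
--   (m+1)·(n+i choose 2i)(i+1 choose m+1) C_i = (n choose m)(k choose j)(n+i choose n).
-- Hence (m+1) times the sum is (n choose m)·(-1)^k·Σ_j (-1)^j (k choose j)(n+m+j choose n),
-- an alternating binomial transform, i.e. the k-th finite difference of
-- x ↦ (x choose n) at x = n+m; it equals (-1)^k (n+m choose n-k) = (-1)^k (n+m choose m).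
-- The same binomial identities give (m+1)(m+n choose 2m) C_m = (n choose m)(n+m choose m),
-- and cancelling m+1 proves the theorem.

open import Defs
open import Data.Nat using (ℕ; zero; suc; _+_; _*_; _∸_; _≤_; _<_; z≤n; s≤s; _!; _/_)
open import Data.Nat.Combinatorics using (_C_; nCk+nC[k+1]≡[n+1]C[k+1]; nCk≡n!/k![n-k]!; k![n∸k]!∣n!; nCk≡nC[n∸k])
open import Data.Nat.Divisibility using (divides)
open import Data.Nat.DivMod using (m/n*n≡m)
import Data.Nat.Properties as NP
open import Data.Nat.Properties using (_!≢0; _!*_!≢0)
import Data.Nat.Tactic.RingSolver as ℕ-Solver
open import Data.Integer using (ℤ; +_) renaming (_*_ to _*ℤ_; _+_ to _+ℤ_; -_ to -ℤ_; _-_ to _-ℤ_)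
import Data.Integer.Properties as ZP
import Data.Integer.Tactic.RingSolver as ℤ-Solver
open import Data.Product using (_,_)
open import Function using (_∘_)
open import Relation.Binary.PropositionalEquality using (_≡_; refl; sym; trans; cong; cong₂; subst; module ≡-Reasoning)
open ≡-Reasoning

binomial-factorials : ∀ {n} b c → n ≡ b + c → (n C b) * (b ! * c !) ≡ n !
binomial-factorials b c refl = begin
    ((b + c) C b) * (b ! * c !)
  ≡⟨ cong (λ t → ((b + c) C b) * (b ! * t !)) (sym (NP.m+n∸m≡n b c)) ⟩
    ((b + c) C b) * (b ! * (b + c ∸ b) !)
  ≡⟨ cong (_* (b ! * (b + c ∸ b) !)) (nCk≡n!/k![n-k]! b≤b+c) ⟩
    ((b + c) ! / (b ! * (b + c ∸ b) !)) {{b !* (b + c ∸ b) !≢0}} * (b ! * (b + c ∸ b) !)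
  ≡⟨ m/n*n≡m {{b !* (b + c ∸ b) !≢0}} (k![n∸k]!∣n! b≤b+c) ⟩
    (b + c) !
  ∎
  where
  b≤b+c = NP.m≤m+n b c

cancel-factorials : ∀ a b {x y} → x * (a ! * b !) ≡ y * (a ! * b !) → x ≡ y
cancel-factorials a b = NP.*-cancelʳ-≡ _ _ _ {{a !* b !≢0}}

binomial-neighbours : ∀ {n} a b → n ≡ suc a + b →
  suc a * (n C suc a) ≡ suc b * (n C a)
binomial-neighbours {n} a b n≡ = cancel-factorials a b (begin
    suc a * (n C suc a) * (a ! * b !)
  ≡⟨ shift (suc a) (n C suc a) (a !) (b !) ⟩
    (n C suc a) * (suc a ! * b !)
  ≡⟨ binomial-factorials (suc a) b n≡ ⟩
    n !
  ≡⟨ sym (binomial-factorials a (suc b) (trans n≡ (sym (NP.+-suc a b)))) ⟩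
    (n C a) * (a ! * suc b !)
  ≡⟨ shift′ (suc b) (n C a) (a !) (b !) ⟩
    suc b * (n C a) * (a ! * b !)
  ∎)
  where
  shift : ∀ s X A B → s * X * (A * B) ≡ X * (s * A * B)
  shift = ℕ-Solver.solve-∀
  shift′ : ∀ s X A B → X * (A * (s * B)) ≡ s * X * (A * B)
  shift′ = ℕ-Solver.solve-∀

absorption : ∀ a b → suc a * (suc (a + b) C suc a) ≡ suc (a + b) * ((a + b) C a)
absorption a b = cancel-factorials a b (begin
    suc a * (suc (a + b) C suc a) * (a ! * b !)
  ≡⟨ shift (suc a) (suc (a + b) C suc a) (a !) (b !) ⟩
    (suc (a + b) C suc a) * (suc a ! * b !)
  ≡⟨ binomial-factorials (suc a) b refl ⟩
    suc (a + b) * (a + b) !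
  ≡⟨ cong (suc (a + b) *_) (sym (binomial-factorials a b refl)) ⟩
    suc (a + b) * (((a + b) C a) * (a ! * b !))
  ≡⟨ sym (NP.*-assoc (suc (a + b)) ((a + b) C a) (a ! * b !)) ⟩
    suc (a + b) * ((a + b) C a) * (a ! * b !)
  ∎)
  where
  shift : ∀ s X A B → s * X * (A * B) ≡ X * (s * A * B)
  shift = ℕ-Solver.solve-∀

-- Trinomial revision: choosing a+b out of a+b+c and then a out of those is
-- the same as choosing a first and then b out of the remaining b+c.
trinomial-revision : ∀ a b c →
  ((a + b + c) C (a + b)) * ((a + b) C a) ≡ ((a + b + c) C a) * ((b + c) C b)
trinomial-revision a b c = NP.*-cancelʳ-≡ _ _ (a ! * b ! * c !) {{a!b!c!≢0}} (begin
    P * Q * (a ! * b ! * c !)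
  ≡⟨ group-left P Q (a !) (b !) (c !) ⟩
    P * ((Q * (a ! * b !)) * c !)
  ≡⟨ cong (λ t → P * (t * c !)) (binomial-factorials a b refl) ⟩
    P * ((a + b) ! * c !)
  ≡⟨ binomial-factorials (a + b) c refl ⟩
    (a + b + c) !
  ≡⟨ sym (binomial-factorials a (b + c) (NP.+-assoc a b c)) ⟩
    R * (a ! * (b + c) !)
  ≡⟨ cong (λ t → R * (a ! * t)) (sym (binomial-factorials b c refl)) ⟩
    R * (a ! * (S * (b ! * c !)))
  ≡⟨ group-right R S (a !) (b !) (c !) ⟩
    R * S * (a ! * b ! * c !)
  ∎)
  where
  P = (a + b + c) C (a + b)
  Q = (a + b) C a
  R = (a + b + c) C a
  S = (b + c) C b
  a!b!c!≢0 = NP.m*n≢0 _ _ {{a !* b !≢0}} {{c !≢0}}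
  group-left : ∀ P Q A B C → P * Q * (A * B * C) ≡ P * ((Q * (A * B)) * C)
  group-left = ℕ-Solver.solve-∀
  group-right : ∀ R S A B C → R * (A * (S * (B * C))) ≡ R * S * (A * B * C)
  group-right = ℕ-Solver.solve-∀

binomial-symmetric : ∀ a b → (a + b) C b ≡ (a + b) C a
binomial-symmetric a b = trans (nCk≡nC[n∸k] (NP.m≤n+m b a)) (cong ((a + b) C_) (NP.m+n∸n≡m a b))

-- The cofactor is (2i choose i) - (2i choose i+1),
-- because (i+1)·(2i choose i+1) = i·(2i choose i).
catalan-formula : ∀ i → catalan i * suc i ≡ (2 * i) C i
catalan-formula i = m/n*n≡m (divides (A ∸ B) (sym cofactor))
  where
  A = (2 * i) C i
  B = (2 * i) C suc i
  central-neighbours : ∀ i → suc i * ((2 * i) C suc i) ≡ i * ((2 * i) C i)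
  central-neighbours zero = refl
  central-neighbours (suc i) = binomial-neighbours (suc i) i (double-suc i)
    where
    double-suc : ∀ i → 2 * suc i ≡ suc (suc i) + i
    double-suc = ℕ-Solver.solve-∀
  cofactor : (A ∸ B) * suc i ≡ A
  cofactor = begin
      (A ∸ B) * suc i
    ≡⟨ NP.*-distribʳ-∸ (suc i) A B ⟩
      A * suc i ∸ B * suc i
    ≡⟨ cong₂ _∸_ (NP.*-comm A (suc i)) (NP.*-comm B (suc i)) ⟩
      A + i * A ∸ suc i * B
    ≡⟨ cong (A + i * A ∸_) (central-neighbours i) ⟩
      A + i * A ∸ i * A
    ≡⟨ NP.m+n∸n≡m A (i * A) ⟩
      A
    ∎

central-revision : ∀ i l → let n = i + l in
  ((n + i) C (2 * i)) * ((2 * i) C i) ≡ ((n + i) C i) * (n C i)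
central-revision i l = begin
    ((i + l + i) C (2 * i)) * ((2 * i) C i)
  ≡⟨ cong₂ (λ N s → (N C s) * (s C i)) (reorder i l) (double i) ⟩
    ((i + i + l) C (i + i)) * ((i + i) C i)
  ≡⟨ trinomial-revision i i l ⟩
    ((i + i + l) C i) * ((i + l) C i)
  ≡⟨ cong (λ N → (N C i) * ((i + l) C i)) (sym (reorder i l)) ⟩
    ((i + l + i) C i) * ((i + l) C i)
  ∎
  where
  reorder : ∀ i l → i + l + i ≡ i + i + l
  reorder = ℕ-Solver.solve-∀
  double : ∀ i → 2 * i ≡ i + i
  double = ℕ-Solver.solve-∀

summand : ℕ → ℕ → ℕ → ℕ
summand m n i = ((n + i) C (2 * i)) * ((suc i C suc m) * catalan i)

summand-factorisation : ∀ m j l → let i = m + j ; n = i + l ; k = j + l in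
  suc m * summand m n i ≡ (n C m) * ((k C j) * ((n + i) C n))
summand-factorisation m j l = begin
    suc m * (P * (A * c))
  ≡⟨ pull-in (suc m) P A c ⟩
    P * ((suc m * A) * c)
  ≡⟨ cong (λ t → P * (t * c)) (absorption m j) ⟩
    P * ((suc i * (i C m)) * c)
  ≡⟨ regroup P (suc i) (i C m) c ⟩
    (i C m) * (P * (c * suc i))
  ≡⟨ cong (λ t → (i C m) * (P * t)) (catalan-formula i) ⟩
    (i C m) * (P * ((2 * i) C i))
  ≡⟨ cong ((i C m) *_) (central-revision i l) ⟩
    (i C m) * (((n + i) C i) * (n C i))
  ≡⟨ rotate (i C m) ((n + i) C i) (n C i) ⟩
    ((n C i) * (i C m)) * ((n + i) C i)
  ≡⟨ cong₂ _*_ (trinomial-revision m j l) (binomial-symmetric n i) ⟩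
    ((n C m) * (k C j)) * ((n + i) C n)
  ≡⟨ NP.*-assoc (n C m) (k C j) ((n + i) C n) ⟩
    (n C m) * ((k C j) * ((n + i) C n))
  ∎
  where
  i = m + j
  n = i + l
  k = j + l
  P = (n + i) C (2 * i)
  A = suc i C suc m
  c = catalan i
  pull-in : ∀ s P A c → s * (P * (A * c)) ≡ P * ((s * A) * c)
  pull-in = ℕ-Solver.solve-∀
  regroup : ∀ P s B c → P * ((s * B) * c) ≡ B * (P * (c * s))
  regroup = ℕ-Solver.solve-∀
  rotate : ∀ B X Y → B * (X * Y) ≡ (Y * B) * X
  rotate = ℕ-Solver.solve-∀

Σ : ℕ → (ℕ → ℤ) → ℤ
Σ zero    f = + 0
Σ (suc N) f = f 0 +ℤ Σ N (f ∘ suc)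

Σ-cong : ∀ N {f g : ℕ → ℤ} → (∀ j → j < N → f j ≡ g j) → Σ N f ≡ Σ N g
Σ-cong zero    f≗g = refl
Σ-cong (suc N) f≗g = cong₂ _+ℤ_ (f≗g 0 (s≤s z≤n)) (Σ-cong N (λ j j<N → f≗g (suc j) (s≤s j<N)))

Σ-zero : ∀ N f → (∀ j → f j ≡ + 0) → Σ N f ≡ + 0
Σ-zero zero    f f≗0 = refl
Σ-zero (suc N) f f≗0 = cong₂ _+ℤ_ (f≗0 0) (Σ-zero N (f ∘ suc) (f≗0 ∘ suc))

Σ-snoc : ∀ N f → Σ (suc N) f ≡ Σ N f +ℤ f N
Σ-snoc zero    f = trans (ZP.+-identityʳ (f 0)) (sym (ZP.+-identityˡ (f 0)))
Σ-snoc (suc N) f = trans (cong (f 0 +ℤ_) (Σ-snoc N (f ∘ suc))) (sym (ZP.+-assoc (f 0) _ _))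

Σ-+ : ∀ N f g → Σ N (λ j → f j +ℤ g j) ≡ Σ N f +ℤ Σ N g
Σ-+ zero    f g = refl
Σ-+ (suc N) f g = trans (cong (f 0 +ℤ g 0 +ℤ_) (Σ-+ N (f ∘ suc) (g ∘ suc))) (interchange (f 0) (g 0) _ _)
  where
  interchange : ∀ a b c d → a +ℤ b +ℤ (c +ℤ d) ≡ a +ℤ c +ℤ (b +ℤ d)
  interchange = ℤ-Solver.solve-∀

Σ-neg : ∀ N f → Σ N (λ j → -ℤ f j) ≡ -ℤ Σ N f
Σ-neg zero    f = refl
Σ-neg (suc N) f = trans (cong (-ℤ f 0 +ℤ_) (Σ-neg N (f ∘ suc))) (sym (ZP.neg-distrib-+ (f 0) _))

Σ-scale : ∀ N c f → Σ N (λ j → c *ℤ f j) ≡ c *ℤ Σ N f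
Σ-scale zero    c f = sym (ZP.*-zeroʳ c)
Σ-scale (suc N) c f = trans (cong (c *ℤ f 0 +ℤ_) (Σ-scale N c (f ∘ suc))) (sym (ZP.*-distribˡ-+ c (f 0) _))

sumRange-from-zero : ∀ m k f → sumRange m (m + k) f ≡ Σ (suc k) (λ j → f (m + j))
sumRange-from-zero m k f = trans (cong (λ t → sumFrom m t f) (NP.m+n∸m≡n m k)) (sumFrom-Σ k)
  where
  sumFrom-Σ : ∀ k → sumFrom m k f ≡ Σ (suc k) (λ j → f (m + j))
  sumFrom-Σ zero    = trans (cong f (sym (NP.+-identityʳ m))) (sym (ZP.+-identityʳ _))
  sumFrom-Σ (suc k) = trans (cong (_+ℤ f (m + suc k)) (sumFrom-Σ k)) (sym (Σ-snoc (suc k) (λ j → f (m + j))))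

sign-+ : ∀ a b → sign (a + b) ≡ sign a *ℤ sign b
sign-+ zero    b = sym (ZP.*-identityˡ _)
sign-+ (suc a) b = trans (cong -ℤ_ (sign-+ a b)) (ZP.neg-distribˡ-* (sign a) (sign b))

sign-squared : ∀ a → sign a *ℤ sign a ≡ + 1
sign-squared zero    = refl
sign-squared (suc a) = trans (neg-square (sign a)) (sign-squared a)
  where
  neg-square : ∀ s → (-ℤ s) *ℤ (-ℤ s) ≡ s *ℤ s
  neg-square = ℤ-Solver.solve-∀

sign-cancel : ∀ k z → sign k *ℤ (sign k *ℤ z) ≡ z
sign-cancel k z = begin
    sign k *ℤ (sign k *ℤ z)
  ≡⟨ sym (ZP.*-assoc (sign k) (sign k) z) ⟩
    sign k *ℤ sign k *ℤ z
  ≡⟨ cong (_*ℤ z) (sign-squared k) ⟩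
    + 1 *ℤ z
  ≡⟨ ZP.*-identityˡ z ⟩
    z
  ∎

sign-∸ : ∀ k j → j ≤ k → sign (k ∸ j) ≡ sign k *ℤ sign j
sign-∸ k j j≤k = sym (begin
    sign k *ℤ sign j
  ≡⟨ cong (λ t → sign t *ℤ sign j) (sym (NP.m∸n+n≡m j≤k)) ⟩
    sign (k ∸ j + j) *ℤ sign j
  ≡⟨ cong (_*ℤ sign j) (sign-+ (k ∸ j) j) ⟩
    sign (k ∸ j) *ℤ sign j *ℤ sign j
  ≡⟨ ZP.*-assoc (sign (k ∸ j)) (sign j) (sign j) ⟩
    sign (k ∸ j) *ℤ (sign j *ℤ sign j)
  ≡⟨ cong (sign (k ∸ j) *ℤ_) (sign-squared j) ⟩
    sign (k ∸ j) *ℤ + 1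
  ≡⟨ ZP.*-identityʳ _ ⟩
    sign (k ∸ j)
  ∎)

-- The alternating binomial transform  Δ N k g = Σ_{j<N} (-1)^j (k choose j) g j.
-- For N > k it is (-1)^k times the k-th forward difference of g at 0.
Δ : ℕ → ℕ → (ℕ → ℤ) → ℤ
Δ N k g = Σ N (λ j → sign j *ℤ (+ (k C j) *ℤ g j))

-- Pascal's rule turns the transform for k+1 into a difference of transforms for k.
Δ-pascal : ∀ N k g → Δ (suc N) (suc k) g ≡ Δ (suc N) k g -ℤ Δ N k (g ∘ suc)
Δ-pascal N k g = begin
    g₀ +ℤ Σ N (λ j → term (suc k) (suc j))
  ≡⟨ cong (g₀ +ℤ_) (Σ-cong N (λ j _ → pascal-term j)) ⟩
    g₀ +ℤ Σ N (λ j → term k (suc j) +ℤ -ℤ shifted j)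
  ≡⟨ cong (g₀ +ℤ_) (trans (Σ-+ N _ _) (cong (Σ N (term k ∘ suc) +ℤ_) (Σ-neg N shifted))) ⟩
    g₀ +ℤ (Σ N (term k ∘ suc) -ℤ Δ N k (g ∘ suc))
  ≡⟨ sym (ZP.+-assoc g₀ _ _) ⟩
    Δ (suc N) k g -ℤ Δ N k (g ∘ suc)
  ∎
  where
  term : ℕ → ℕ → ℤ
  term k′ j = sign j *ℤ (+ (k′ C j) *ℤ g j)
  g₀ : ℤ
  g₀ = term k 0
  shifted : ℕ → ℤ
  shifted j = sign j *ℤ (+ (k C j) *ℤ g (suc j))
  split : ∀ s a b h → (-ℤ s) *ℤ ((a +ℤ b) *ℤ h) ≡ (-ℤ s) *ℤ (b *ℤ h) +ℤ -ℤ (s *ℤ (a *ℤ h))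
  split = ℤ-Solver.solve-∀
  pascal-term : ∀ j → term (suc k) (suc j) ≡ term k (suc j) +ℤ -ℤ shifted j
  pascal-term j = begin
      sign (suc j) *ℤ (+ (suc k C suc j) *ℤ g (suc j))
    ≡⟨ cong (λ t → sign (suc j) *ℤ (t *ℤ g (suc j)))
         (trans (cong +_ (sym (nCk+nC[k+1]≡[n+1]C[k+1] k j))) (ZP.pos-+ (k C j) (k C suc j))) ⟩
      sign (suc j) *ℤ ((+ (k C j) +ℤ + (k C suc j)) *ℤ g (suc j))
    ≡⟨ split (sign j) (+ (k C j)) (+ (k C suc j)) (g (suc j)) ⟩
      term k (suc j) +ℤ -ℤ shifted j
    ∎

Δ-binomial : ∀ k N x r → k < N → k ≤ r →
  Δ N k (λ j → + ((x + j) C r)) ≡ sign k *ℤ + (x C (r ∸ k))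
Δ-binomial zero (suc N) x r _ _ = begin
    + 1 *ℤ (+ 1 *ℤ + ((x + 0) C r)) +ℤ Σ N (λ j → sign (suc j) *ℤ (+ 0 *ℤ + ((x + suc j) C r)))
  ≡⟨ cong₂ _+ℤ_ (cong (λ t → + 1 *ℤ (+ 1 *ℤ + (t C r))) (NP.+-identityʳ x))
                (Σ-zero N _ (λ j → ZP.*-zeroʳ (sign (suc j)))) ⟩
    + 1 *ℤ (+ 1 *ℤ + (x C r)) +ℤ + 0
  ≡⟨ ZP.+-identityʳ _ ⟩
    + 1 *ℤ (+ 1 *ℤ + (x C r))
  ≡⟨ ZP.*-identityˡ _ ⟩
    + 1 *ℤ + (x C r)
  ∎
Δ-binomial (suc k) (suc N) x (suc r) (s≤s k<N) (s≤s k≤r) = begin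
    Δ (suc N) (suc k) g
  ≡⟨ Δ-pascal N k g ⟩
    Δ (suc N) k g -ℤ Δ N k (g ∘ suc)
  ≡⟨ cong₂ _-ℤ_ (Δ-binomial k (suc N) x (suc r) (NP.m≤n⇒m≤1+n k<N) (NP.m≤n⇒m≤1+n k≤r))
        (trans (Σ-cong N (λ j _ → cong (λ t → sign j *ℤ (+ (k C j) *ℤ + (t C suc r))) (NP.+-suc x j)))
               (Δ-binomial k N (suc x) (suc r) k<N (NP.m≤n⇒m≤1+n k≤r))) ⟩
    sign k *ℤ + (x C (suc r ∸ k)) -ℤ sign k *ℤ + (suc x C (suc r ∸ k))
  ≡⟨ cong (λ t → sign k *ℤ + (x C t) -ℤ sign k *ℤ + (suc x C t)) (NP.+-∸-assoc 1 k≤r) ⟩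
    sign k *ℤ + (x C suc t) -ℤ sign k *ℤ + (suc x C suc t)
  ≡⟨ cong (λ u → sign k *ℤ + (x C suc t) -ℤ sign k *ℤ u)
        (trans (cong +_ (sym (nCk+nC[k+1]≡[n+1]C[k+1] x t))) (ZP.pos-+ (x C t) (x C suc t))) ⟩
    sign k *ℤ + (x C suc t) -ℤ sign k *ℤ (+ (x C t) +ℤ + (x C suc t))
  ≡⟨ difference (sign k) (+ (x C t)) (+ (x C suc t)) ⟩
    sign (suc k) *ℤ + (x C t)
  ∎
  where
  g : ℕ → ℤ
  g j = + ((x + j) C suc r)
  t : ℕ
  t = r ∸ k
  difference : ∀ s a c → s *ℤ c -ℤ s *ℤ (a +ℤ c) ≡ (-ℤ s) *ℤ a
  difference = ℤ-Solver.solve-∀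

summand-factorisation′ : ∀ m k j → j ≤ k →
  suc m * summand m (m + k) (m + j) ≡ ((m + k) C m) * ((k C j) * ((m + k + (m + j)) C (m + k)))
summand-factorisation′ m k j j≤k with NP.m≤n⇒∃[o]m+o≡n j≤k
... | l , refl = subst (λ n → suc m * summand m n (m + j) ≡ (n C m) * (((j + l) C j) * ((n + (m + j)) C n)))
                       (NP.+-assoc m j l) (summand-factorisation m j l)

rhs-factorisation : ∀ m k → let n = m + k in
  suc m * (((m + n) C (2 * m)) * catalan m) ≡ (n C m) * ((n + m) C m)
rhs-factorisation m k = begin
    suc m * (((m + n) C (2 * m)) * catalan m)
  ≡⟨ pull-in (suc m) ((m + n) C (2 * m)) (catalan m) ⟩
    ((m + n) C (2 * m)) * (catalan m * suc m)
  ≡⟨ cong₂ (λ N t → (N C (2 * m)) * t) (NP.+-comm m n) (catalan-formula m) ⟩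
    ((n + m) C (2 * m)) * ((2 * m) C m)
  ≡⟨ central-revision m k ⟩
    ((n + m) C m) * (n C m)
  ≡⟨ NP.*-comm ((n + m) C m) (n C m) ⟩
    (n C m) * ((n + m) C m)
  ∎
  where
  n = m + k
  pull-in : ∀ s X c → s * (X * c) ≡ X * (c * s)
  pull-in = ℕ-Solver.solve-∀

scaled-sum-as-transform : ∀ m k → let n = m + k in
  + suc m *ℤ sumRange m n (λ i → sign (n ∸ i) *ℤ + summand m n i)
    ≡ + (n C m) *ℤ (sign k *ℤ Δ (suc k) k (λ j → + ((n + m + j) C n)))
scaled-sum-as-transform m k = begin
    + suc m *ℤ sumRange m n f
  ≡⟨ cong (+ suc m *ℤ_) (sumRange-from-zero m k f) ⟩
    + suc m *ℤ Σ (suc k) (λ j → f (m + j))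
  ≡⟨ sym (Σ-scale (suc k) (+ suc m) (λ j → f (m + j))) ⟩
    Σ (suc k) (λ j → + suc m *ℤ f (m + j))
  ≡⟨ Σ-cong (suc k) (λ j j<1+k → scaled-term j (NP.≤-pred j<1+k)) ⟩
    Σ (suc k) (λ j → + (n C m) *ℤ (sign k *ℤ (sign j *ℤ (+ (k C j) *ℤ g j))))
  ≡⟨ Σ-scale (suc k) (+ (n C m)) (λ j → sign k *ℤ term j) ⟩
    + (n C m) *ℤ Σ (suc k) (λ j → sign k *ℤ term j)
  ≡⟨ cong (+ (n C m) *ℤ_) (Σ-scale (suc k) (sign k) term) ⟩
    + (n C m) *ℤ (sign k *ℤ Δ (suc k) k g)
  ∎
  where
  n = m + k
  f : ℕ → ℤ
  f i = sign (n ∸ i) *ℤ + summand m n i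
  g : ℕ → ℤ
  g j = + ((n + m + j) C n)
  term : ℕ → ℤ
  term j = sign j *ℤ (+ (k C j) *ℤ g j)
  swap : ∀ a σ t → a *ℤ (σ *ℤ t) ≡ σ *ℤ (a *ℤ t)
  swap = ℤ-Solver.solve-∀
  regroup : ∀ σₖ σⱼ a b c → σₖ *ℤ σⱼ *ℤ (a *ℤ (b *ℤ c)) ≡ a *ℤ (σₖ *ℤ (σⱼ *ℤ (b *ℤ c)))
  regroup = ℤ-Solver.solve-∀
  scaled-term : ∀ j → j ≤ k → + suc m *ℤ f (m + j) ≡ + (n C m) *ℤ (sign k *ℤ (sign j *ℤ (+ (k C j) *ℤ g j)))
  scaled-term j j≤k = begin
      + suc m *ℤ (sign (n ∸ (m + j)) *ℤ + summand m n (m + j))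
    ≡⟨ swap (+ suc m) (sign (n ∸ (m + j))) (+ summand m n (m + j)) ⟩
      sign (n ∸ (m + j)) *ℤ (+ suc m *ℤ + summand m n (m + j))
    ≡⟨ cong₂ (λ d t → sign d *ℤ t) (NP.[m+n]∸[m+o]≡n∸o m k j)
         (trans (sym (ZP.pos-* (suc m) (summand m n (m + j)))) (cong +_ (summand-factorisation′ m k j j≤k))) ⟩
      sign (k ∸ j) *ℤ + ((n C m) * ((k C j) * ((n + (m + j)) C n)))
    ≡⟨ cong₂ (λ σ N → σ *ℤ + ((n C m) * ((k C j) * (N C n)))) (sign-∸ k j j≤k) (sym (NP.+-assoc n m j)) ⟩
      sign k *ℤ sign j *ℤ + ((n C m) * ((k C j) * ((n + m + j) C n)))
    ≡⟨ cong (sign k *ℤ sign j *ℤ_) (trans (ZP.pos-* (n C m) ((k C j) * ((n + m + j) C n))) (cong (+ (n C m) *ℤ_) (ZP.pos-* (k C j) ((n + m + j) C n)))) ⟩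
      sign k *ℤ sign j *ℤ (+ (n C m) *ℤ (+ (k C j) *ℤ g j))
    ≡⟨ regroup (sign k) (sign j) (+ (n C m)) (+ (k C j)) (g j) ⟩
      + (n C m) *ℤ (sign k *ℤ (sign j *ℤ (+ (k C j) *ℤ g j)))
    ∎

mainTheorem4 : (m n : ℕ) → m ≤ n →
    sumRange m n (λ i → sign (n ∸ i) *ℤ (+ (((n + i) C (2 * i)) * ((suc i C suc m) * catalan i))))
      ≡ + (((m + n) C (2 * m)) * catalan m)
mainTheorem4 m n m≤n with NP.m≤n⇒∃[o]m+o≡n m≤n
... | k , refl = ZP.*-cancelˡ-≡ (+ suc m) _ _ (begin
    + suc m *ℤ sumRange m (m + k) (λ i → sign (m + k ∸ i) *ℤ + summand m (m + k) i)
  ≡⟨ scaled-sum-as-transform m k ⟩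
    + (n′ C m) *ℤ (sign k *ℤ Δ (suc k) k (λ j → + ((n′ + m + j) C n′)))
  ≡⟨ cong (λ t → + (n′ C m) *ℤ (sign k *ℤ t)) (Δ-binomial k (suc k) (n′ + m) n′ NP.≤-refl (NP.m≤n+m k m)) ⟩
    + (n′ C m) *ℤ (sign k *ℤ (sign k *ℤ + ((n′ + m) C (n′ ∸ k))))
  ≡⟨ cong (+ (n′ C m) *ℤ_) (sign-cancel k _) ⟩
    + (n′ C m) *ℤ + ((n′ + m) C (n′ ∸ k))
  ≡⟨ cong (λ t → + (n′ C m) *ℤ + ((n′ + m) C t)) (NP.m+n∸n≡m m k) ⟩
    + (n′ C m) *ℤ + ((n′ + m) C m)
  ≡⟨ sym (ZP.pos-* (n′ C m) _) ⟩
    + ((n′ C m) * ((n′ + m) C m))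
  ≡⟨ cong +_ (sym (rhs-factorisation m k)) ⟩
    + (suc m * (((m + n′) C (2 * m)) * catalan m))
  ≡⟨ ZP.pos-* (suc m) _ ⟩
    + suc m *ℤ + (((m + n′) C (2 * m)) * catalan m)
  ∎)
  where
  n′ = m + k
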